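{- Let $n,\ell,u$ be nonnegative integers with $n\ge \ell+u$, let $p\in(0,1)$, $q=1-p$. Fix $L\subseteq\{0,\dots,\ell-1\}$ and $U\subseteq\{n-u,\dots,n-1\}$. Let $R$ be a random subset of $\{\ell,\dots,n-u-1\}$, each element included independently with probability $p$, and set $A=L\cup R\cup U$. Then for every integer $i$ with $2\ell-1\le i\le n-u-1$, $$\mathbb{P}(i\notin A+A)=\begin{cases}q^{|L|}(1-p^2)^{\frac{i+1}{2}-\ell} & \text{if } i \text{ is odd},\\ q^{|L|+1}(1-p^2)^{\frac{i}{2}-\ell} & \text{if } i \text{ is even}.\end{cases}$$
   Context: $A+A=\{a+a':a,a'\in A\}$. -}

module Defs where

open import Level using (Level)
open import Data.Bool using (Bool; true; false; _∧_; if_then_else_)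
open import Data.Nat as ℕ using (ℕ; zero; suc; _∸_)
open import Data.Fin using (Fin; toℕ)
open import Data.Fin.Properties using (any?)
open import Data.Fin.Subset using (Subset; _∈_; _⊆_; _∪_; ∣_∣)
open import Data.Fin.Subset.Properties using (_∈?_; _⊆?_)
open import Data.Integer as ℤ using (ℤ; +_)
open import Data.List using (List; []; _∷_; map; _++_; filter)
open import Data.Vec using (Vec; tabulate; []; _∷_)
open import Data.Product using (∃₂; _×_; _,_)
open import Relation.Binary.PropositionalEquality using (_≡_)
open import Relation.Nullary using (Dec; does; yes; no)
open import Relation.Nullary.Decidable using (_×-dec_)
open import Algebra.Bundles using (CommutativeRing)

allSubsets : (n : ℕ) → List (Subset n)
allSubsets zero = [] ∷ []
allSubsets (suc n) = map (true ∷_) (allSubsets n) ++ map (false ∷_) (allSubsets n)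

Mid : (n ℓ u : ℕ) → Subset n
Mid n ℓ u = tabulate (λ k → does (ℓ ℕ.≤? toℕ k) ∧ does (toℕ k ℕ.<? n ∸ u))

_∈SumSet_ : {n : ℕ} → ℤ → Subset n → Set
i ∈SumSet A = ∃₂ λ a a' → a ∈ A × a' ∈ A × (+ (toℕ a ℕ.+ toℕ a') ≡ i)

_∈SumSet?_ : {n : ℕ} → (i : ℤ) → (A : Subset n) → Dec (i ∈SumSet A)
i ∈SumSet? A with any? (λ a → any? (λ a' → (a ∈? A) ×-dec ((a' ∈? A) ×-dec (+ (toℕ a ℕ.+ toℕ a') ℤ.≟ i))))
... | yes (a , a' , p) = yes (a , a' , p)
... | no ¬p = no (λ { (a , a' , p) → ¬p (a , a' , p) })

module Prob {c r : Level} (𝓡 : CommutativeRing c r) where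
  open CommutativeRing 𝓡 public
  open import Algebra.Properties.Semiring.Exp semiring public using (_^_)

  sumR : List Carrier → Carrier
  sumR [] = 0#
  sumR (x ∷ xs) = x + sumR xs

  -- Probability (as an exact polynomial expression in p) that i ∉ A + A, where
  -- A = L ∪ R ∪ U and R is a p-random subset of {ℓ,…,n-u-1}:
  --   Σ_{R ⊆ Mid} p^|R| (1-p)^(|Mid|-|R|) · [i ∉ (L ∪ R ∪ U) + (L ∪ R ∪ U)].
  probNotInSumSet : (n ℓ u : ℕ) → (L U : Subset n) → (p : Carrier) → ℤ → Carrier
  probNotInSumSet n ℓ u L U p i =
    sumR (map term (filter (λ R → R ⊆? Mid n ℓ u) (allSubsets n)))
    where
      q = 1# - p
      term : Subset n → Carrier
      term R = (p ^ ∣ R ∣) * ((q ^ (∣ Mid n ℓ u ∣ ∸ ∣ R ∣))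
               * (if does (i ∈SumSet? ((L ∪ R) ∪ U)) then 0# else 1#))

module Submission where

-- Write A = L ∪ R ∪ U and, for j ≥ 0, split the candidate
-- representations j = a + (j - a) into the pairs {a, j - a} with a ≤ ⌊j/2⌋.
-- Then j ∉ A + A iff no pair lies inside A, so its indicator is the product
-- of the factors 1 - [a ∈ A][j - a ∈ A].  Because 2ℓ - 1 ≤ j < n - u, every
-- pair meets the random part R, and distinct pairs are disjoint sets of
-- coordinates, so the factors are independent and the probability is the
-- product of their expectations:  1 - p (resp. 1) for a < ℓ with a ∈ L
-- (resp. a ∉ L), 1 - p² for ℓ ≤ a < j - a, and 1 - p for the central
-- a = j - a when j is even.  The remaining value i = -1 (possible only for
-- ℓ = 0) is never a sum, and L is then empty.

open import Defs
open import Level using (Level; 0ℓ)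
open import Data.Bool using (Bool; true; false; _∧_; _∨_; if_then_else_)
open import Data.Bool.Properties using (∨-identityʳ; ∧-idem; ¬-not)
open import Data.Nat as ℕ using (ℕ; zero; suc; _∸_; ⌊_/2⌋; _≤_; _<_; z≤n; s≤s; z<s; s<s; _≟_; _≤?_; _<?_)
import Data.Nat.Properties as ℕₚ
open import Data.Nat.Properties
  using ( ≤-trans; ≤-reflexive; ≤-total; <⇒≤; <⇒≢; <⇒≱; ≰⇒>; ≤-<-trans; <-≤-trans
        ; n<1+n; m≤n⇒m≤1+n; m≤m+n; +-mono-≤; +-monoʳ-≤; +-monoʳ-<; +-suc
        ; m+n≤o⇒m≤o; m+n≤o⇒m≤o∸n; m+[n∸m]≡n; m+n∸m≡n; m∸n≤m; +-∸-assoc; ∸-monoʳ-<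
        ; n≤0⇒n≡0; m+n≡0⇒m≡0; 0∸n≡0; n≡⌊n+n/2⌋ )
open import Data.Nat.Divisibility using (divides; ∣1⇒≡1; ∣m+n∣m⇒∣n)
open import Data.Fin using (Fin; toℕ) renaming (zero to fzero; suc to fsuc)
open import Data.Fin.Subset using (Subset; _∈_; _⊆_; _∪_; ∣_∣)
open import Data.Fin.Subset.Properties using (_⊆?_; ⊆-refl; in⊆in; out⊆; p⊆q⇒∣p∣≤∣q∣)
open import Data.Vec using ([]; _∷_; tabulate; here; there)
open import Data.Integer as ℤ using (ℤ; +_; -[1+_])
open import Data.Integer.Divisibility using (_∣_)
open import Data.Integer.Properties using (+-injective)
open import Data.List as List using (List; map; filter; _++_)
open import Data.List.Properties using (map-++; map-∘)
open import Data.Product using (Σ; ∃; _×_; _,_)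
open import Data.Sum using (_⊎_; inj₁; inj₂; swap)
open import Data.Empty using (⊥)
open import Function using (_∘_)
open import Relation.Nullary using (¬_; Dec; yes; no; does; contradiction)
open import Relation.Nullary.Decidable using (dec-true; dec-false; _⊎-dec_)
open import Relation.Unary using (Pred; Decidable; ∁)
open import Relation.Binary.PropositionalEquality as ≡ using (_≡_; _≢_; cong; cong₂; subst; subst₂)
open import Algebra.Bundles using (CommutativeRing)

-- Boolean membership of a natural number in a subset of {0,…,n-1} (false
-- beyond n).  Natural-number indices keep the arithmetic on a and j ∸ a free
-- of Fin bookkeeping.
mem : ∀ {n} → Subset n → ℕ → Bool
mem [] _ = false
mem (b ∷ A) zero = b
mem (b ∷ A) (suc x) = mem A x

mem-∪ : ∀ {n} (A B : Subset n) x → mem (A ∪ B) x ≡ (mem A x ∨ mem B x)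
mem-∪ [] [] x = ≡.refl
mem-∪ (a ∷ A) (b ∷ B) zero = ≡.refl
mem-∪ (a ∷ A) (b ∷ B) (suc x) = mem-∪ A B x

mem-tabulate : ∀ n (g : ℕ → Bool) x → x < n → mem (tabulate {n = n} (g ∘ toℕ)) x ≡ g x
mem-tabulate (suc n) g zero _ = ≡.refl
mem-tabulate (suc n) g (suc x) (s<s x<n) = mem-tabulate n (g ∘ suc) x x<n

mem→∈ : ∀ {n} (A : Subset n) x → mem A x ≡ true → Σ (Fin n) λ k → toℕ k ≡ x × k ∈ A
mem→∈ (true ∷ A) zero _ = fzero , ≡.refl , here
mem→∈ (false ∷ A) zero ()
mem→∈ (b ∷ A) (suc x) x∈A with mem→∈ A x x∈A
... | k , ≡.refl , k∈A = fsuc k , ≡.refl , there k∈A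

∈→mem : ∀ {n} (A : Subset n) k → k ∈ A → mem A (toℕ k) ≡ true
∈→mem (true ∷ A) fzero here = ≡.refl
∈→mem (b ∷ A) (fsuc k) (there k∈A) = ∈→mem A k k∈A

mem-all : ∀ {n} {P : ℕ → Set} (A : Subset n) → (∀ k → k ∈ A → P (toℕ k)) → ∀ x → mem A x ≡ true → P x
mem-all A all x x∈A with mem→∈ A x x∈A
... | k , ≡.refl , k∈A = all k k∈A

mem-⊆ : ∀ {n} {A B : Subset n} x → A ⊆ B → mem A x ≡ true → mem B x ≡ true
mem-⊆ {A = A} {B} x A⊆B = mem-all A (λ k k∈A → ∈→mem B k (A⊆B k∈A)) x

∈SumSet-intro : ∀ {n} (A : Subset n) {j a} → a ≤ j → mem A a ≡ true → mem A (j ∸ a) ≡ true → (+ j) ∈SumSet A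
∈SumSet-intro A {j} {a} a≤j a∈A b∈A with mem→∈ A a a∈A | mem→∈ A (j ∸ a) b∈A
... | k , ≡.refl , k∈A | k' , k'≡j∸a , k'∈A =
  k , k' , k∈A , k'∈A , cong +_ (≡.trans (cong (toℕ k ℕ.+_) k'≡j∸a) (m+[n∸m]≡n a≤j))

smaller-summand : ∀ {n} (A : Subset n) {x y j} → x ℕ.+ y ≡ j → x ≤ y → mem A x ≡ true → mem A y ≡ true →
  ∃ λ a → a ℕ.+ a ≤ j × mem A a ≡ true × mem A (j ∸ a) ≡ true
smaller-summand A {x} {y} ≡.refl x≤y x∈A y∈A =
  x , +-monoʳ-≤ x x≤y , x∈A , subst (λ z → mem A z ≡ true) (≡.sym (m+n∸m≡n x y)) y∈A

∈SumSet-elim : ∀ {n} (A : Subset n) {j} → (+ j) ∈SumSet A → ∃ λ a → a ℕ.+ a ≤ j × mem A a ≡ true × mem A (j ∸ a) ≡ true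
∈SumSet-elim A (k , k' , k∈A , k'∈A , sum≡j) with ≤-total (toℕ k) (toℕ k')
... | inj₁ x≤y = smaller-summand A (+-injective sum≡j) x≤y (∈→mem A k k∈A) (∈→mem A k' k'∈A)
... | inj₂ y≤x = smaller-summand A (≡.trans (ℕₚ.+-comm (toℕ k') (toℕ k)) (+-injective sum≡j)) y≤x
                   (∈→mem A k' k'∈A) (∈→mem A k k∈A)

Pair : ℕ → ℕ → Pred ℕ 0ℓ
Pair a b x = x ≡ a ⊎ x ≡ b

pairs-disjoint : ∀ {j a b} → a < b → b ℕ.+ b ≤ j → ∀ x → Pair a (j ∸ a) x → Pair b (j ∸ b) x → ⊥
pairs-disjoint {j} {a} {b} a<b 2b≤j x = disjoint
  where
  b≤j∸b : b ≤ j ∸ b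
  b≤j∸b = m+n≤o⇒m≤o∸n b 2b≤j
  j∸b<j∸a : j ∸ b < j ∸ a
  j∸b<j∸a = ∸-monoʳ-< a<b (m+n≤o⇒m≤o b 2b≤j)
  disjoint : Pair a (j ∸ a) x → Pair b (j ∸ b) x → ⊥
  disjoint (inj₁ x≡a) (inj₁ x≡b) = <⇒≢ a<b (≡.trans (≡.sym x≡a) x≡b)
  disjoint (inj₁ x≡a) (inj₂ x≡j∸b) = <⇒≢ (<-≤-trans a<b b≤j∸b) (≡.trans (≡.sym x≡a) x≡j∸b)
  disjoint (inj₂ x≡j∸a) (inj₁ x≡b) = <⇒≢ (≤-<-trans b≤j∸b j∸b<j∸a) (≡.trans (≡.sym x≡b) x≡j∸a)
  disjoint (inj₂ x≡j∸a) (inj₂ x≡j∸b) = <⇒≢ j∸b<j∸a (≡.trans (≡.sym x≡j∸b) x≡j∸a)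

double-bound : ∀ {ℓ j} → 2 ℕ.* ℓ ≤ j ℕ.+ 1 → ℓ ℕ.+ ℓ ≤ suc j
double-bound {ℓ} {j} 2ℓ≤j+1 =
  subst₂ _≤_ (cong (ℓ ℕ.+_) (ℕₚ.+-identityʳ ℓ)) (ℕₚ.+-comm j 1) 2ℓ≤j+1

partner-above : ∀ {ℓ j a} → ℓ ℕ.+ ℓ ≤ suc j → a < ℓ → ℓ ≤ j ∸ a
partner-above {ℓ} {j} {a} 2ℓ≤j+1 a<ℓ =
  m+n≤o⇒m≤o∸n ℓ (ℕₚ.≤-pred (≤-trans (subst (_≤ ℓ ℕ.+ ℓ) (+-suc ℓ a) (+-monoʳ-≤ ℓ a<ℓ)) 2ℓ≤j+1))

data Halves : ℕ → Set where
  even : ∀ m → Halves (m ℕ.+ m)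
  odd : ∀ m → Halves (suc (m ℕ.+ m))

halves : ∀ j → Halves j
halves zero = even 0
halves (suc j) with halves j
... | even m = odd m
... | odd m rewrite ≡.sym (+-suc m m) = even (suc m)

half-bound : ∀ {a m} → a ℕ.+ a ≤ suc (m ℕ.+ m) → a ≤ m
half-bound {a} {m} 2a≤2m+1 with a ≤? m
... | yes a≤m = a≤m
... | no a≰m = contradiction 2a≤2m+1 (<⇒≱ (begin-strict
    suc (m ℕ.+ m)       <⟨ n<1+n _ ⟩
    suc (suc (m ℕ.+ m)) ≡⟨ cong suc (≡.sym (+-suc m m)) ⟩
    suc m ℕ.+ suc m     ≤⟨ +-mono-≤ (≰⇒> a≰m) (≰⇒> a≰m) ⟩
    a ℕ.+ a             ∎))
  where open ℕₚ.≤-Reasoning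

half-even : ∀ m → ⌊ m ℕ.+ m /2⌋ ≡ m
half-even m = ≡.sym (n≡⌊n+n/2⌋ m)

half-odd : ∀ m → ⌊ suc (m ℕ.+ m) ℕ.+ 1 /2⌋ ≡ suc m
half-odd m = ≡.trans (cong ⌊_/2⌋ (ℕₚ.+-comm (suc (m ℕ.+ m)) 1)) (cong suc (half-even m))

even-divisible : ∀ m → + 2 ∣ + (m ℕ.+ m)
even-divisible m = divides m (≡.trans (cong (m ℕ.+_) (≡.sym (ℕₚ.+-identityʳ m))) (ℕₚ.*-comm 2 m))

odd-not-divisible : ∀ m → ¬ (+ 2 ∣ + suc (m ℕ.+ m))
odd-not-divisible m 2∣2m+1 = contradiction (∣1⇒≡1 2∣1) λ ()
  where
  2∣1 : + 2 ∣ + 1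
  2∣1 = ∣m+n∣m⇒∣n (subst (λ x → + 2 ∣ + x) (ℕₚ.+-comm 1 (m ℕ.+ m)) 2∣2m+1) (even-divisible m)

-- The p-random subset R of a fixed M ⊆ {0,…,n-1}, for p in any commutative
-- ring, presented through its expectation operator.
module RandomSubset {c r : Level} (𝓡 : CommutativeRing c r) (p : CommutativeRing.Carrier 𝓡) where
  open Prob 𝓡 renaming (refl to ≈-refl) hiding (zero)
  open import Algebra.Properties.Ring ring using (-0#≈0#; x[y-z]≈xy-xz; -‿+-comm)
  open import Algebra.Properties.CommutativeSemigroup +-commutativeSemigroup using (interchange)
  open import Algebra.Properties.CommutativeSemigroup *-commutativeSemigroup using (x∙yz≈y∙xz)
  open import Relation.Binary.Reasoning.Setoid setoid

  q : Carrier
  q = 1# - p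

  𝟙 : Bool → Carrier
  𝟙 true = 1#
  𝟙 false = 0#

  𝟙-∧ : ∀ b b' → 𝟙 (b ∧ b') ≈ 𝟙 b * 𝟙 b'
  𝟙-∧ true _ = sym (*-identityˡ _)
  𝟙-∧ false _ = sym (zeroˡ _)

  1-0≈1 : 1# - 0# ≈ 1#
  1-0≈1 = trans (+-congˡ -0#≈0#) (+-identityʳ 1#)

  p+q≈1 : p + q ≈ 1#
  p+q≈1 = begin
    p + (1# - p)   ≈⟨ +-congˡ (+-comm 1# (- p)) ⟩
    p + (- p + 1#) ≈⟨ +-assoc p (- p) 1# ⟨
    p - p + 1#     ≈⟨ +-congʳ (-‿inverseʳ p) ⟩
    0# + 1#        ≈⟨ +-identityˡ 1# ⟩
    1#             ∎

  mix-idem : ∀ x → p * x + q * x ≈ x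
  mix-idem x = begin
    p * x + q * x ≈⟨ distribʳ x p q ⟨
    (p + q) * x   ≈⟨ *-congʳ p+q≈1 ⟩
    1# * x        ≈⟨ *-identityˡ x ⟩
    x             ∎

  -- E M f is the expected value of f R, where each element of M lies in R
  -- independently with probability p (and R ⊆ M).
  E : ∀ {n} → Subset n → (Subset n → Carrier) → Carrier
  E [] f = f []
  E (true ∷ M) f = p * E M (λ R → f (true ∷ R)) + q * E M (λ R → f (false ∷ R))
  E (false ∷ M) f = E M (λ R → f (false ∷ R))

  E-cong : ∀ {n} (M : Subset n) {f g : Subset n → Carrier} → (∀ R → R ⊆ M → f R ≈ g R) → E M f ≈ E M g
  E-cong [] f≈g = f≈g [] ⊆-refl
  E-cong (true ∷ M) f≈g = +-cong (*-congˡ (E-cong M λ R R⊆M → f≈g _ (in⊆in R⊆M)))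
                                 (*-congˡ (E-cong M λ R R⊆M → f≈g _ (out⊆ R⊆M)))
  E-cong (false ∷ M) f≈g = E-cong M λ R R⊆M → f≈g _ (out⊆ R⊆M)

  E-const : ∀ {n} (M : Subset n) x → E M (λ _ → x) ≈ x
  E-const [] x = ≈-refl
  E-const (true ∷ M) x = trans (+-cong (*-congˡ (E-const M x)) (*-congˡ (E-const M x))) (mix-idem x)
  E-const (false ∷ M) x = E-const M x

  E-complement : ∀ {n} (M : Subset n) f → E M (λ R → 1# - f R) ≈ 1# - E M f
  E-complement [] f = ≈-refl
  E-complement (true ∷ M) f = begin
    p * E M (λ R → 1# - f₁ R) + q * E M (λ R → 1# - f₀ R)
      ≈⟨ +-cong (*-congˡ (E-complement M f₁)) (*-congˡ (E-complement M f₀)) ⟩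
    p * (1# - E M f₁) + q * (1# - E M f₀)
      ≈⟨ +-cong (x[y-z]≈xy-xz p 1# (E M f₁)) (x[y-z]≈xy-xz q 1# (E M f₀)) ⟩
    (p * 1# - p * E M f₁) + (q * 1# - q * E M f₀)
      ≈⟨ interchange (p * 1#) (- (p * E M f₁)) (q * 1#) (- (q * E M f₀)) ⟩
    (p * 1# + q * 1#) + (- (p * E M f₁) + - (q * E M f₀))
      ≈⟨ +-cong (mix-idem 1#) (-‿+-comm (p * E M f₁) (q * E M f₀)) ⟩
    1# - E (true ∷ M) f ∎
    where
    f₁ f₀ : Subset _ → Carrier
    f₁ R = f (true ∷ R)
    f₀ R = f (false ∷ R)
  E-complement (false ∷ M) f = E-complement M _

  E-mem : ∀ {n} (M : Subset n) x → mem M x ≡ true → E M (λ R → 𝟙 (mem R x)) ≈ p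
  E-mem [] x ()
  E-mem (true ∷ M) zero _ = begin
    p * E M (λ _ → 1#) + q * E M (λ _ → 0#) ≈⟨ +-cong (*-congˡ (E-const M 1#)) (*-congˡ (E-const M 0#)) ⟩
    p * 1# + q * 0#                         ≈⟨ +-cong (*-identityʳ p) (zeroʳ q) ⟩
    p + 0#                                  ≈⟨ +-identityʳ p ⟩
    p                                       ∎
  E-mem (true ∷ M) (suc x) x∈M = trans (+-cong (*-congˡ (E-mem M x x∈M)) (*-congˡ (E-mem M x x∈M))) (mix-idem p)
  E-mem (false ∷ M) zero ()
  E-mem (false ∷ M) (suc x) x∈M = E-mem M x x∈M

  DependsOn : ∀ {n} → Pred ℕ 0ℓ → (Subset n → Carrier) → Set r
  DependsOn S f = ∀ R R' → (∀ k → S k → mem R k ≡ mem R' k) → f R ≈ f R'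

  DependsOn-tail : ∀ {n} {S : Pred ℕ 0ℓ} {f : Subset (suc n) → Carrier} b →
    DependsOn S f → DependsOn (S ∘ suc) (λ R → f (b ∷ R))
  DependsOn-tail b dep R R' agree = dep (b ∷ R) (b ∷ R') λ { zero _ → ≡.refl ; (suc k) → agree k }

  ignores-head : ∀ {n} {S : Pred ℕ 0ℓ} {f : Subset (suc n) → Carrier} →
    DependsOn S f → ¬ S 0 → ∀ R → f (false ∷ R) ≈ f (true ∷ R)
  ignores-head dep ¬S0 R = dep (false ∷ R) (true ∷ R) λ { zero S0 → contradiction S0 ¬S0 ; (suc k) _ → ≡.refl }

  factor-head : ∀ {n} (M : Subset n) (f g : Subset (suc n) → Carrier) →
    (∀ R → g (false ∷ R) ≈ g (true ∷ R)) →
    (∀ b → E M (λ R → f (b ∷ R) * g (b ∷ R)) ≈ E M (λ R → f (b ∷ R)) * E M (λ R → g (b ∷ R))) →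
    E (true ∷ M) (λ R → f R * g R) ≈ E (true ∷ M) f * E (true ∷ M) g
  factor-head M f g g-ignores-head branches = begin
    p * E M (λ R → f (true ∷ R) * g (true ∷ R)) + q * E M (λ R → f (false ∷ R) * g (false ∷ R))
      ≈⟨ +-cong (*-congˡ (branches true)) (*-congˡ (branches false)) ⟩
    p * (F₁ * G₁) + q * (F₀ * G₀) ≈⟨ +-congˡ (*-congˡ (*-congˡ G₀≈G₁)) ⟩
    p * (F₁ * G₁) + q * (F₀ * G₁) ≈⟨ +-cong (*-assoc p F₁ G₁) (*-assoc q F₀ G₁) ⟨
    p * F₁ * G₁ + q * F₀ * G₁     ≈⟨ distribʳ G₁ (p * F₁) (q * F₀) ⟨
    (p * F₁ + q * F₀) * G₁        ≈⟨ *-congˡ (trans (+-congˡ (*-congˡ G₀≈G₁)) (mix-idem G₁)) ⟨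
    (p * F₁ + q * F₀) * (p * G₁ + q * G₀) ∎
    where
    F₁ F₀ G₁ G₀ : Carrier
    F₁ = E M (λ R → f (true ∷ R))
    F₀ = E M (λ R → f (false ∷ R))
    G₁ = E M (λ R → g (true ∷ R))
    G₀ = E M (λ R → g (false ∷ R))
    G₀≈G₁ : G₀ ≈ G₁
    G₀≈G₁ = E-cong M λ R _ → g-ignores-head R

  independent : ∀ {n} (M : Subset n) {S T : Pred ℕ 0ℓ} (f g : Subset n → Carrier) →
    (∀ k → ¬ S k ⊎ ¬ T k) → DependsOn S f → DependsOn T g →
    E M (λ R → f R * g R) ≈ E M f * E M g
  independent [] f g sep df dg = ≈-refl
  independent (false ∷ M) f g sep df dg =
    independent M (λ R → f (false ∷ R)) (λ R → g (false ∷ R)) (sep ∘ suc)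
      (DependsOn-tail false df) (DependsOn-tail false dg)
  independent (true ∷ M) f g sep df dg with sep 0
  ... | inj₂ ¬T0 = factor-head M f g (ignores-head dg ¬T0) λ b →
    independent M (λ R → f (b ∷ R)) (λ R → g (b ∷ R)) (sep ∘ suc) (DependsOn-tail b df) (DependsOn-tail b dg)
  ... | inj₁ ¬S0 = begin
    E (true ∷ M) (λ R → f R * g R) ≈⟨ E-cong (true ∷ M) (λ R _ → *-comm (f R) (g R)) ⟩
    E (true ∷ M) (λ R → g R * f R) ≈⟨ factor-head M g f (ignores-head df ¬S0) (λ b →
      independent M (λ R → g (b ∷ R)) (λ R → f (b ∷ R)) (swap ∘ sep ∘ suc) (DependsOn-tail b dg) (DependsOn-tail b df)) ⟩
    E (true ∷ M) g * E (true ∷ M) f ≈⟨ *-comm _ _ ⟩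
    E (true ∷ M) f * E (true ∷ M) g ∎

  E-mem-pair : ∀ {n} (M : Subset n) {x y} → x ≢ y → mem M x ≡ true → mem M y ≡ true →
    E M (λ R → 𝟙 (mem R x ∧ mem R y)) ≈ p * p
  E-mem-pair M {x} {y} x≢y x∈M y∈M = begin
    E M (λ R → 𝟙 (mem R x ∧ mem R y))              ≈⟨ E-cong M (λ R _ → 𝟙-∧ (mem R x) (mem R y)) ⟩
    E M (λ R → 𝟙 (mem R x) * 𝟙 (mem R y))          ≈⟨ independent M _ _ separated (only x) (only y) ⟩
    E M (λ R → 𝟙 (mem R x)) * E M (λ R → 𝟙 (mem R y)) ≈⟨ *-cong (E-mem M x x∈M) (E-mem M y y∈M) ⟩
    p * p                                             ∎
    where
    only : ∀ z → DependsOn (_≡ z) (λ R → 𝟙 (mem R z))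
    only z R R' agree = reflexive (cong 𝟙 (agree z ≡.refl))
    separated : ∀ k → ¬ k ≡ x ⊎ ¬ k ≡ y
    separated k with k ≟ x
    ... | yes k≡x = inj₂ λ k≡y → x≢y (≡.trans (≡.sym k≡x) k≡y)
    ... | no k≢x = inj₁ k≢x

  prod : ℕ → (ℕ → Carrier) → Carrier
  prod zero G = 1#
  prod (suc k) G = G 0 * prod k (λ a → G (suc a))

  prod-cong : ∀ k {G H : ℕ → Carrier} → (∀ a → a < k → G a ≈ H a) → prod k G ≈ prod k H
  prod-cong zero _ = ≈-refl
  prod-cong (suc k) G≈H = *-cong (G≈H 0 z<s) (prod-cong k λ a a<k → G≈H (suc a) (s<s a<k))

  prod-split : ∀ k d (G : ℕ → Carrier) → prod (k ℕ.+ d) G ≈ prod k G * prod d (λ a → G (k ℕ.+ a))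
  prod-split zero d G = sym (*-identityˡ _)
  prod-split (suc k) d G = trans (*-congˡ (prod-split k d (λ a → G (suc a)))) (sym (*-assoc _ _ _))

  prod-snoc : ∀ k (G : ℕ → Carrier) → prod (suc k) G ≈ prod k G * G k
  prod-snoc zero G = *-comm (G 0) 1#
  prod-snoc (suc k) G = trans (*-congˡ (prod-snoc k (λ a → G (suc a)))) (sym (*-assoc _ _ _))

  prod-zero : ∀ k (G : ℕ → Carrier) a → a < k → G a ≈ 0# → prod k G ≈ 0#
  prod-zero (suc k) G zero _ G0≈0 = trans (*-congʳ G0≈0) (zeroˡ _)
  prod-zero (suc k) G (suc a) (s<s a<k) Ga≈0 = trans (*-congˡ (prod-zero k _ a a<k Ga≈0)) (zeroʳ _)

  prod-ones : ∀ k (G : ℕ → Carrier) → (∀ a → a < k → G a ≈ 1#) → prod k G ≈ 1#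
  prod-ones zero G _ = ≈-refl
  prod-ones (suc k) G ones = trans (*-cong (ones 0 z<s) (prod-ones k _ λ a a<k → ones (suc a) (s<s a<k))) (*-identityˡ 1#)

  prod-constant : ∀ k (G : ℕ → Carrier) x → (∀ a → a < k → G a ≈ x) → prod k G ≈ x ^ k
  prod-constant zero G x _ = ≈-refl
  prod-constant (suc k) G x G≈x = *-cong (G≈x 0 z<s) (prod-constant k _ x λ a a<k → G≈x (suc a) (s<s a<k))

  prod-card : ∀ {n} (A : Subset n) x → prod n (λ a → if mem A a then x else 1#) ≈ x ^ ∣ A ∣
  prod-card [] x = ≈-refl
  prod-card (true ∷ A) x = *-congˡ (prod-card A x)
  prod-card (false ∷ A) x = trans (*-identityˡ _) (prod-card A x)

  prod-card-below : ∀ {n} (A : Subset n) k x → k ≤ n → (∀ a → mem A a ≡ true → a < k) →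
    prod k (λ a → if mem A a then x else 1#) ≈ x ^ ∣ A ∣
  prod-card-below {n} A k x k≤n below = begin
    prod k G                                 ≈⟨ *-identityʳ _ ⟨
    prod k G * 1#                            ≈⟨ *-congˡ (prod-ones (n ∸ k) _ λ a _ → outside (k ℕ.+ a) (m≤m+n k a)) ⟨
    prod k G * prod (n ∸ k) (λ a → G (k ℕ.+ a)) ≈⟨ prod-split k (n ∸ k) G ⟨
    prod (k ℕ.+ (n ∸ k)) G                   ≡⟨ cong (λ t → prod t G) (m+[n∸m]≡n k≤n) ⟩
    prod n G                                 ≈⟨ prod-card A x ⟩
    x ^ ∣ A ∣                                ∎
    where
    G : ℕ → Carrier
    G a = if mem A a then x else 1#
    outside : ∀ a → k ≤ a → G a ≈ 1#
    outside a k≤a rewrite ¬-not {mem A a} {true} (λ a∈A → <⇒≱ (below a a∈A) k≤a) = ≈-refl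

  prod-depends : ∀ {n} k {T : Pred ℕ 0ℓ} (G : ℕ → Subset n → Carrier) →
    (∀ a → a < k → DependsOn T (G a)) → DependsOn T (λ R → prod k (λ a → G a R))
  prod-depends zero G _ R R' _ = ≈-refl
  prod-depends (suc k) G dG R R' agree =
    *-cong (dG 0 z<s R R' agree) (prod-depends k (λ a → G (suc a)) (λ a a<k → dG (suc a) (s<s a<k)) R R' agree)

  E-prod : ∀ {n} (M : Subset n) k (F : ℕ → Subset n → Carrier) (S : ℕ → Pred ℕ 0ℓ) →
    (∀ a → Decidable (S a)) → (∀ a → DependsOn (S a) (F a)) →
    (∀ a b → a < b → b < k → ∀ x → S a x → S b x → ⊥) →
    E M (λ R → prod k (λ a → F a R)) ≈ prod k (λ a → E M (F a))
  E-prod M zero F S S? dF disjoint = E-const M 1#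
  E-prod M (suc k) F S S? dF disjoint = begin
    E M (λ R → F 0 R * prod k (λ a → F (suc a) R))
      ≈⟨ independent M (F 0) _ separated (dF 0) (prod-depends k _ rest-avoids-S₀) ⟩
    E M (F 0) * E M (λ R → prod k (λ a → F (suc a) R))
      ≈⟨ *-congˡ (E-prod M k (F ∘ suc) (S ∘ suc) (S? ∘ suc) (dF ∘ suc)
                   λ a b a<b b<k → disjoint (suc a) (suc b) (s<s a<b) (s<s b<k)) ⟩
    E M (F 0) * prod k (λ a → E M (F (suc a))) ∎
    where
    separated : ∀ x → ¬ S 0 x ⊎ ¬ ∁ (S 0) x
    separated x with S? 0 x
    ... | yes s = inj₂ λ ¬s → ¬s s
    ... | no ¬s = inj₁ ¬s
    rest-avoids-S₀ : ∀ a → a < k → DependsOn (∁ (S 0)) (F (suc a))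
    rest-avoids-S₀ a a<k R R' agree =
      dF (suc a) R R' λ x s → agree x λ s₀ → disjoint 0 (suc a) z<s (s<s a<k) x s₀ s

  sumR-++ : ∀ xs ys → sumR (xs ++ ys) ≈ sumR xs + sumR ys
  sumR-++ List.[] ys = sym (+-identityˡ _)
  sumR-++ (x List.∷ xs) ys = trans (+-congˡ (sumR-++ xs ys)) (sym (+-assoc _ _ _))

  sumR-filter : ∀ {A : Set} {P : Pred A 0ℓ} (P? : Decidable P) (w : A → Carrier) xs →
    sumR (map w (filter P? xs)) ≈ sumR (map (λ x → if does (P? x) then w x else 0#) xs)
  sumR-filter P? w List.[] = ≈-refl
  sumR-filter P? w (x List.∷ xs) with does (P? x)
  ... | true = +-congˡ (sumR-filter P? w xs)
  ... | false = trans (sumR-filter P? w xs) (sym (+-identityˡ _))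

  sumR-map-cong : ∀ {A : Set} {g h : A → Carrier} xs → (∀ x → g x ≈ h x) → sumR (map g xs) ≈ sumR (map h xs)
  sumR-map-cong List.[] _ = ≈-refl
  sumR-map-cong (x List.∷ xs) g≈h = +-cong (g≈h x) (sumR-map-cong xs g≈h)

  sumR-map-scale : ∀ {A : Set} c (g : A → Carrier) xs → sumR (map (λ x → c * g x) xs) ≈ c * sumR (map g xs)
  sumR-map-scale c g List.[] = sym (zeroʳ c)
  sumR-map-scale c g (x List.∷ xs) = trans (+-congˡ (sumR-map-scale c g xs)) (sym (distribˡ c _ _))

  sumR-map-zero : ∀ {A : Set} (xs : List A) → sumR (map (λ _ → 0#) xs) ≈ 0#
  sumR-map-zero List.[] = ≈-refl
  sumR-map-zero (x List.∷ xs) = trans (+-identityˡ _) (sumR-map-zero xs)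

  sumSubsets : ∀ n → (Subset n → Carrier) → Carrier
  sumSubsets n g = sumR (map g (allSubsets n))

  sumSubsets-suc : ∀ n (g : Subset (suc n) → Carrier) →
    sumSubsets (suc n) g ≈ sumSubsets n (λ R → g (true ∷ R)) + sumSubsets n (λ R → g (false ∷ R))
  sumSubsets-suc n g = begin
    sumR (map g (map (true ∷_) S ++ map (false ∷_) S))             ≡⟨ cong sumR (map-++ g (map (true ∷_) S) (map (false ∷_) S)) ⟩
    sumR (map g (map (true ∷_) S) ++ map g (map (false ∷_) S))     ≈⟨ sumR-++ (map g (map (true ∷_) S)) (map g (map (false ∷_) S)) ⟩
    sumR (map g (map (true ∷_) S)) + sumR (map g (map (false ∷_) S))
      ≡⟨ ≡.sym (cong₂ (λ xs ys → sumR xs + sumR ys) (map-∘ S) (map-∘ S)) ⟩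
    sumSubsets n (λ R → g (true ∷ R)) + sumSubsets n (λ R → g (false ∷ R)) ∎
    where
    S : List (Subset n)
    S = allSubsets n

  contribution : ∀ {n} → Subset n → (Subset n → Carrier) → Subset n → Carrier
  contribution M f R = if does (R ⊆? M) then p ^ ∣ R ∣ * (q ^ (∣ M ∣ ∸ ∣ R ∣) * f R) else 0#

  sumSubsets≈E : ∀ {n} (M : Subset n) f → sumSubsets n (contribution M f) ≈ E M f
  sumSubsets≈E [] f = trans (+-identityʳ _) (trans (*-identityˡ _) (*-identityˡ _))
  sumSubsets≈E {suc n} (true ∷ M) f = begin
    sumSubsets (suc n) (contribution (true ∷ M) f) ≈⟨ sumSubsets-suc n _ ⟩
    sumSubsets n (λ R → contribution (true ∷ M) f (true ∷ R)) + sumSubsets n (λ R → contribution (true ∷ M) f (false ∷ R))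
      ≈⟨ +-cong (sumR-map-cong (allSubsets n) with-0) (sumR-map-cong (allSubsets n) without-0) ⟩
    sumSubsets n (λ R → p * contribution M f₁ R) + sumSubsets n (λ R → q * contribution M f₀ R)
      ≈⟨ +-cong (sumR-map-scale p (contribution M f₁) (allSubsets n)) (sumR-map-scale q (contribution M f₀) (allSubsets n)) ⟩
    p * sumSubsets n (contribution M f₁) + q * sumSubsets n (contribution M f₀)
      ≈⟨ +-cong (*-congˡ (sumSubsets≈E M f₁)) (*-congˡ (sumSubsets≈E M f₀)) ⟩
    E (true ∷ M) f ∎
    where
    f₁ f₀ : Subset n → Carrier
    f₁ R = f (true ∷ R)
    f₀ R = f (false ∷ R)
    with-0 : ∀ R → contribution (true ∷ M) f (true ∷ R) ≈ p * contribution M f₁ R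
    with-0 R with R ⊆? M
    ... | yes _ = *-assoc p _ _
    ... | no _ = sym (zeroʳ p)
    without-0 : ∀ R → contribution (true ∷ M) f (false ∷ R) ≈ q * contribution M f₀ R
    without-0 R with R ⊆? M
    ... | yes R⊆M rewrite +-∸-assoc 1 (p⊆q⇒∣p∣≤∣q∣ R⊆M) = begin
      p ^ ∣ R ∣ * (q * q ^ (∣ M ∣ ∸ ∣ R ∣) * f₀ R)   ≈⟨ *-congˡ (*-assoc q _ _) ⟩
      p ^ ∣ R ∣ * (q * (q ^ (∣ M ∣ ∸ ∣ R ∣) * f₀ R)) ≈⟨ x∙yz≈y∙xz _ q _ ⟩
      q * (p ^ ∣ R ∣ * (q ^ (∣ M ∣ ∸ ∣ R ∣) * f₀ R)) ∎
    ... | no _ = sym (zeroʳ q)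
  sumSubsets≈E {suc n} (false ∷ M) f = begin
    sumSubsets (suc n) (contribution (false ∷ M) f) ≈⟨ sumSubsets-suc n _ ⟩
    sumSubsets n (λ _ → 0#) + sumSubsets n (contribution M (λ R → f (false ∷ R)))
      ≈⟨ +-cong (sumR-map-zero (allSubsets n)) (sumSubsets≈E M _) ⟩
    0# + E (false ∷ M) f ≈⟨ +-identityˡ _ ⟩
    E (false ∷ M) f ∎

  notInSum : ∀ {n} → ℤ → Subset n → Carrier
  notInSum i A = if does (i ∈SumSet? A) then 0# else 1#

  probNotInSumSet≈E : ∀ n ℓ u (L U : Subset n) i →
    probNotInSumSet n ℓ u L U p i ≈ E (Mid n ℓ u) (λ R → notInSum i ((L ∪ R) ∪ U))
  probNotInSumSet≈E n ℓ u L U i =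
    trans (sumR-filter (_⊆? Mid n ℓ u) _ (allSubsets n)) (sumSubsets≈E (Mid n ℓ u) _)

  pair-present : ∀ {b b'} → b ≡ true → b' ≡ true → 1# - 𝟙 (b ∧ b') ≈ 0#
  pair-present ≡.refl ≡.refl = -‿inverseʳ 1#

  pair-absent : ∀ b b' → ¬ (b ≡ true × b' ≡ true) → 1# - 𝟙 (b ∧ b') ≈ 1#
  pair-absent true true both = contradiction (≡.refl , ≡.refl) both
  pair-absent true false _ = 1-0≈1
  pair-absent false _ _ = 1-0≈1

  notInSum≈prod : ∀ {n} (A : Subset n) j k → (∀ a → a ℕ.+ a ≤ j → a < k) → (∀ a → a < k → a ≤ j) →
    notInSum (+ j) A ≈ prod k (λ a → 1# - 𝟙 (mem A a ∧ mem A (j ∸ a)))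
  notInSum≈prod A j k below-k below-j = by-cases ((+ j) ∈SumSet? A)
    where
    by-cases : (d : Dec ((+ j) ∈SumSet A)) → (if does d then 0# else 1#) ≈ prod k (λ a → 1# - 𝟙 (mem A a ∧ mem A (j ∸ a)))
    by-cases (yes j∈A+A) with ∈SumSet-elim A j∈A+A
    ... | a , a+a≤j , a∈A , j-a∈A = sym (prod-zero k _ a (below-k a a+a≤j) (pair-present a∈A j-a∈A))
    by-cases (no j∉A+A) = sym (prod-ones k _ λ a a<k → pair-absent _ _ λ (a∈A , j-a∈A) →
      j∉A+A (∈SumSet-intro A (below-j a a<k) a∈A j-a∈A))

module Setting {c r : Level} (𝓡 : CommutativeRing c r) (p : CommutativeRing.Carrier 𝓡)
  {n ℓ u : ℕ} (ℓ+u≤n : ℓ ℕ.+ u ≤ n) (L U : Subset n)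
  (L-low : ∀ k → k ∈ L → toℕ k < ℓ) (U-high : ∀ k → k ∈ U → n ∸ u ≤ toℕ k) where
  open Prob 𝓡 renaming (refl to ≈-refl) hiding (zero)
  open RandomSubset 𝓡 p
  open import Relation.Binary.Reasoning.Setoid setoid
  open import Algebra.Properties.Semiring.Exp semiring using (^-homo-*)
  open import Algebra.Properties.CommutativeSemigroup *-commutativeSemigroup using (xy∙z≈xz∙y)

  A : Subset n → Subset n
  A R = (L ∪ R) ∪ U

  mem-A : ∀ R x → mem (A R) x ≡ ((mem L x ∨ mem R x) ∨ mem U x)
  mem-A R x = ≡.trans (mem-∪ (L ∪ R) U x) (cong (_∨ mem U x) (mem-∪ L R x))

  L-above : ∀ {x} → ℓ ≤ x → mem L x ≡ false
  L-above ℓ≤x = ¬-not λ x∈L → <⇒≱ (mem-all L L-low _ x∈L) ℓ≤x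

  U-below : ∀ {x} → x < n ∸ u → mem U x ≡ false
  U-below x<n-u = ¬-not λ x∈U → <⇒≱ x<n-u (mem-all U U-high _ x∈U)

  Middle : Subset n
  Middle = Mid n ℓ u

  middle-in : ∀ {x} → ℓ ≤ x → x < n ∸ u → mem Middle x ≡ true
  middle-in {x} ℓ≤x x<n-u =
    ≡.trans (mem-tabulate n (λ y → does (ℓ ≤? y) ∧ does (y <? n ∸ u)) x (<-≤-trans x<n-u (m∸n≤m n u)))
            (cong₂ _∧_ (dec-true (ℓ ≤? x) ℓ≤x) (dec-true (x <? n ∸ u) x<n-u))

  middle-below : ∀ {x} → x < ℓ → mem Middle x ≡ false
  middle-below {x} x<ℓ =
    ≡.trans (mem-tabulate n (λ y → does (ℓ ≤? y) ∧ does (y <? n ∸ u)) x (<-≤-trans x<ℓ (m+n≤o⇒m≤o ℓ ℓ+u≤n)))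
            (cong (_∧ does (x <? n ∸ u)) (dec-false (ℓ ≤? x) (<⇒≱ x<ℓ)))

  A-middle : ∀ R {x} → ℓ ≤ x → x < n ∸ u → mem (A R) x ≡ mem R x
  A-middle R {x} ℓ≤x x<n-u rewrite mem-A R x | L-above ℓ≤x | U-below x<n-u = ∨-identityʳ (mem R x)

  ℓ≤n-u : ℓ ≤ n ∸ u
  ℓ≤n-u = m+n≤o⇒m≤o∸n ℓ ℓ+u≤n

  R-below : ∀ {R x} → R ⊆ Middle → x < ℓ → mem R x ≡ false
  R-below {R} {x} R⊆Middle x<ℓ =
    ¬-not λ x∈R → contradiction (≡.trans (≡.sym (mem-⊆ x R⊆Middle x∈R)) (middle-below x<ℓ)) λ ()

  A-low : ∀ R {x} → R ⊆ Middle → x < ℓ → mem (A R) x ≡ mem L x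
  A-low R {x} R⊆Middle x<ℓ rewrite mem-A R x | R-below R⊆Middle x<ℓ | U-below (<-≤-trans x<ℓ ℓ≤n-u)
    | ∨-identityʳ (mem L x) = ∨-identityʳ (mem L x)

  module AtSum (j : ℕ) (2ℓ≤j+1 : 2 ℕ.* ℓ ≤ j ℕ.+ 1) (j+1≤n-u : j ℕ.+ 1 ≤ n ∸ u) where

    j<n-u : j < n ∸ u
    j<n-u = subst (_≤ n ∸ u) (ℕₚ.+-comm j 1) j+1≤n-u

    ℓ+ℓ≤j+1 : ℓ ℕ.+ ℓ ≤ suc j
    ℓ+ℓ≤j+1 = double-bound {ℓ} 2ℓ≤j+1

    partner-low : ∀ {a} → a < ℓ → ℓ ≤ j ∸ a
    partner-low = partner-above ℓ+ℓ≤j+1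

    partner-high : ∀ a → j ∸ a < n ∸ u
    partner-high a = ≤-<-trans (m∸n≤m j a) j<n-u

    pairFactor : ℕ → Subset n → Carrier
    pairFactor a R = 1# - 𝟙 (mem (A R) a ∧ mem (A R) (j ∸ a))

    -- Since L and U are fixed, the factor of a only looks at coordinates a and j - a of R.
    pairFactor-depends : ∀ a → DependsOn (Pair a (j ∸ a)) (pairFactor a)
    pairFactor-depends a R R' agree =
      reflexive (cong (λ b → 1# - 𝟙 b) (cong₂ _∧_ (A-agrees a (inj₁ ≡.refl)) (A-agrees (j ∸ a) (inj₂ ≡.refl))))
      where
      A-agrees : ∀ x → Pair a (j ∸ a) x → mem (A R) x ≡ mem (A R') x
      A-agrees x s = ≡.trans (mem-A R x)
        (≡.trans (cong (λ b → (mem L x ∨ b) ∨ mem U x) (agree x s)) (≡.sym (mem-A R' x)))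

    E-pairFactor : ∀ a (b : Subset n → Bool) → (∀ R → R ⊆ Middle → (mem (A R) a ∧ mem (A R) (j ∸ a)) ≡ b R) →
      E Middle (pairFactor a) ≈ 1# - E Middle (λ R → 𝟙 (b R))
    E-pairFactor a b simplify =
      trans (E-cong Middle λ R R⊆Middle → reflexive (cong (λ t → 1# - 𝟙 t) (simplify R R⊆Middle)))
            (E-complement Middle _)

    -- a < ℓ: only j - a is random, so the factor has mean q if a ∈ L and 1 otherwise.
    factor-low : ∀ a → a < ℓ → E Middle (pairFactor a) ≈ (if mem L a then q else 1#)
    factor-low a a<ℓ =
      trans (E-pairFactor a (λ R → mem L a ∧ mem R (j ∸ a))
               λ R R⊆Middle → cong₂ _∧_ (A-low R R⊆Middle a<ℓ) (A-middle R (partner-low a<ℓ) (partner-high a)))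
            (by-membership (mem L a))
      where
      by-membership : ∀ b → 1# - E Middle (λ R → 𝟙 (b ∧ mem R (j ∸ a))) ≈ (if b then q else 1#)
      by-membership true = +-congˡ (-‿cong (E-mem Middle (j ∸ a) (middle-in (partner-low a<ℓ) (partner-high a))))
      by-membership false = trans (+-congˡ (-‿cong (E-const Middle 0#))) 1-0≈1

    -- ℓ ≤ a < j - a: two distinct middle elements, so the factor has mean 1 - p².
    factor-middle : ∀ a → ℓ ≤ a → suc (a ℕ.+ a) ≤ j → E Middle (pairFactor a) ≈ 1# - p * p
    factor-middle a ℓ≤a 2a<j =
      trans (E-pairFactor a (λ R → mem R a ∧ mem R (j ∸ a))
               λ R _ → cong₂ _∧_ (A-middle R ℓ≤a a<n-u) (A-middle R ℓ≤j-a (partner-high a)))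
            (+-congˡ (-‿cong (E-mem-pair Middle (<⇒≢ a<j-a) (middle-in ℓ≤a a<n-u) (middle-in ℓ≤j-a (partner-high a)))))
      where
      a<j-a : a < j ∸ a
      a<j-a = m+n≤o⇒m≤o∸n (suc a) 2a<j
      ℓ≤j-a : ℓ ≤ j ∸ a
      ℓ≤j-a = ≤-trans ℓ≤a (<⇒≤ a<j-a)
      a<n-u : a < n ∸ u
      a<n-u = ℕₚ.<-trans a<j-a (partner-high a)

    -- a = j - a: one middle element, so the factor has mean q.
    factor-centre : ∀ a → ℓ ≤ a → a ℕ.+ a ≡ j → E Middle (pairFactor a) ≈ q
    factor-centre a ℓ≤a 2a≡j =
      trans (E-pairFactor a (λ R → mem R a)
               λ R _ → ≡.trans (cong₂ _∧_ (A-middle R ℓ≤a a<n-u) (≡.trans (cong (mem (A R)) j-a≡a) (A-middle R ℓ≤a a<n-u)))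
                                (∧-idem (mem R a)))
            (+-congˡ (-‿cong (E-mem Middle a (middle-in ℓ≤a a<n-u))))
      where
      j-a≡a : j ∸ a ≡ a
      j-a≡a = ≡.trans (cong (_∸ a) (≡.sym 2a≡j)) (m+n∸m≡n a a)
      a<n-u : a < n ∸ u
      a<n-u = subst (_< n ∸ u) j-a≡a (partner-high a)

    E-notInSum : ∀ k → (∀ a → a ℕ.+ a ≤ j → a < k) → (∀ a → a < k → a ℕ.+ a ≤ j) →
      E Middle (λ R → notInSum (+ j) (A R)) ≈ prod k (λ a → E Middle (pairFactor a))
    E-notInSum k below-k pair-ok = trans
      (E-cong Middle λ R _ → notInSum≈prod (A R) j k below-k λ a a<k → m+n≤o⇒m≤o a (pair-ok a a<k))
      (E-prod Middle k pairFactor (λ a → Pair a (j ∸ a)) (λ a x → x ≟ a ⊎-dec x ≟ j ∸ a) pairFactor-depends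
        λ a b a<b b<k → pairs-disjoint a<b (pair-ok b b<k))

    prod-factors : ∀ k → ℓ ≤ k → (∀ a → a < k → suc (a ℕ.+ a) ≤ j) →
      prod k (λ a → E Middle (pairFactor a)) ≈ q ^ ∣ L ∣ * (1# - p * p) ^ (k ∸ ℓ)
    prod-factors k ℓ≤k distinct = begin
      prod k e                                  ≡⟨ cong (λ t → prod t e) (≡.sym (m+[n∸m]≡n ℓ≤k)) ⟩
      prod (ℓ ℕ.+ (k ∸ ℓ)) e                    ≈⟨ prod-split ℓ (k ∸ ℓ) e ⟩
      prod ℓ e * prod (k ∸ ℓ) (λ a → e (ℓ ℕ.+ a)) ≈⟨ *-cong low middle ⟩
      q ^ ∣ L ∣ * (1# - p * p) ^ (k ∸ ℓ)        ∎
      where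
      e : ℕ → Carrier
      e a = E Middle (pairFactor a)
      low : prod ℓ e ≈ q ^ ∣ L ∣
      low = trans (prod-cong ℓ factor-low)
                  (prod-card-below L ℓ q (m+n≤o⇒m≤o ℓ ℓ+u≤n) (mem-all L L-low))
      middle : prod (k ∸ ℓ) (λ a → e (ℓ ℕ.+ a)) ≈ (1# - p * p) ^ (k ∸ ℓ)
      middle = prod-constant (k ∸ ℓ) _ _ λ a a<k-ℓ →
        factor-middle (ℓ ℕ.+ a) (m≤m+n ℓ a) (distinct (ℓ ℕ.+ a) (subst (ℓ ℕ.+ a <_) (m+[n∸m]≡n ℓ≤k) (+-monoʳ-< ℓ a<k-ℓ)))

  odd-sum : ∀ m → 2 ℕ.* ℓ ≤ suc (m ℕ.+ m) ℕ.+ 1 → suc (m ℕ.+ m) ℕ.+ 1 ≤ n ∸ u →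
    probNotInSumSet n ℓ u L U p (+ suc (m ℕ.+ m)) ≈ q ^ ∣ L ∣ * (1# - p * p) ^ (⌊ suc (m ℕ.+ m) ℕ.+ 1 /2⌋ ∸ ℓ)
  odd-sum m 2ℓ≤j+1 j+1≤n-u = begin
    probNotInSumSet n ℓ u L U p (+ j)            ≈⟨ probNotInSumSet≈E n ℓ u L U (+ j) ⟩
    E Middle (λ R → notInSum (+ j) (A R))        ≈⟨ E-notInSum (suc m) (λ a → s≤s ∘ half-bound) within ⟩
    prod (suc m) (λ a → E Middle (pairFactor a)) ≈⟨ prod-factors (suc m) ℓ≤1+m distinct ⟩
    q ^ ∣ L ∣ * (1# - p * p) ^ (suc m ∸ ℓ)       ≡⟨ cong (λ t → q ^ ∣ L ∣ * (1# - p * p) ^ (t ∸ ℓ)) (≡.sym (half-odd m)) ⟩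
    q ^ ∣ L ∣ * (1# - p * p) ^ (⌊ j ℕ.+ 1 /2⌋ ∸ ℓ) ∎
    where
    j : ℕ
    j = suc (m ℕ.+ m)
    open AtSum j 2ℓ≤j+1 j+1≤n-u
    within : ∀ a → a < suc m → a ℕ.+ a ≤ j
    within a (s≤s a≤m) = m≤n⇒m≤1+n (+-mono-≤ a≤m a≤m)
    distinct : ∀ a → a < suc m → suc (a ℕ.+ a) ≤ j
    distinct a (s≤s a≤m) = s≤s (+-mono-≤ a≤m a≤m)
    ℓ≤1+m : ℓ ≤ suc m
    ℓ≤1+m = half-bound (m≤n⇒m≤1+n (≤-trans ℓ+ℓ≤j+1 (≤-reflexive (cong suc (≡.sym (+-suc m m))))))

  even-sum : ∀ m → 2 ℕ.* ℓ ≤ m ℕ.+ m ℕ.+ 1 → m ℕ.+ m ℕ.+ 1 ≤ n ∸ u →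
    probNotInSumSet n ℓ u L U p (+ (m ℕ.+ m)) ≈ q ^ (∣ L ∣ ℕ.+ 1) * (1# - p * p) ^ (⌊ m ℕ.+ m /2⌋ ∸ ℓ)
  even-sum m 2ℓ≤j+1 j+1≤n-u = begin
    probNotInSumSet n ℓ u L U p (+ j)            ≈⟨ probNotInSumSet≈E n ℓ u L U (+ j) ⟩
    E Middle (λ R → notInSum (+ j) (A R))        ≈⟨ E-notInSum (suc m) (λ a → s≤s ∘ half-bound ∘ m≤n⇒m≤1+n) within ⟩
    prod (suc m) e                               ≈⟨ prod-snoc m e ⟩
    prod m e * e m                               ≈⟨ *-cong (prod-factors m ℓ≤m distinct) (factor-centre m ℓ≤m ≡.refl) ⟩
    q ^ ∣ L ∣ * (1# - p * p) ^ (m ∸ ℓ) * q                  ≈⟨ xy∙z≈xz∙y _ _ q ⟩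
    q ^ ∣ L ∣ * q * (1# - p * p) ^ (m ∸ ℓ)                  ≈⟨ *-congʳ (*-congˡ (*-identityʳ q)) ⟨
    q ^ ∣ L ∣ * q ^ 1 * (1# - p * p) ^ (m ∸ ℓ)              ≈⟨ *-congʳ (^-homo-* q ∣ L ∣ 1) ⟨
    q ^ (∣ L ∣ ℕ.+ 1) * (1# - p * p) ^ (m ∸ ℓ)              ≡⟨ cong (λ t → q ^ (∣ L ∣ ℕ.+ 1) * (1# - p * p) ^ (t ∸ ℓ)) (≡.sym (half-even m)) ⟩
    q ^ (∣ L ∣ ℕ.+ 1) * (1# - p * p) ^ (⌊ j /2⌋ ∸ ℓ)        ∎
    where
    j : ℕ
    j = m ℕ.+ m
    open AtSum j 2ℓ≤j+1 j+1≤n-u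
    e : ℕ → Carrier
    e a = E Middle (pairFactor a)
    within : ∀ a → a < suc m → a ℕ.+ a ≤ j
    within a (s≤s a≤m) = +-mono-≤ a≤m a≤m
    distinct : ∀ a → a < m → suc (a ℕ.+ a) ≤ j
    distinct a a<m = +-mono-≤ a<m (<⇒≤ a<m)
    ℓ≤m : ℓ ≤ m
    ℓ≤m = half-bound ℓ+ℓ≤j+1

  -- i = -1 occurs only for ℓ = 0, where L = ∅ and -1 ∉ A + A.
  minus-one : 2 ℕ.* ℓ ≤ 0 → probNotInSumSet n ℓ u L U p -[1+ 0 ] ≈ q ^ ∣ L ∣ * (1# - p * p) ^ (0 ∸ ℓ)
  minus-one 2ℓ≤0 = begin
    probNotInSumSet n ℓ u L U p -[1+ 0 ]        ≈⟨ probNotInSumSet≈E n ℓ u L U -[1+ 0 ] ⟩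
    E Middle (λ R → notInSum -[1+ 0 ] (A R))    ≈⟨ E-cong Middle (λ R _ → reflexive (negative-not-sum (A R))) ⟩
    E Middle (λ _ → 1#)                         ≈⟨ E-const Middle 1# ⟩
    1#                                          ≈⟨ prod-card-below L 0 q z≤n L-empty ⟩
    q ^ ∣ L ∣                                   ≈⟨ *-identityʳ _ ⟨
    q ^ ∣ L ∣ * 1#                              ≡⟨ cong (λ t → q ^ ∣ L ∣ * (1# - p * p) ^ t) (≡.sym (0∸n≡0 ℓ)) ⟩
    q ^ ∣ L ∣ * (1# - p * p) ^ (0 ∸ ℓ)          ∎
    where
    negative-not-sum : ∀ X → notInSum -[1+ 0 ] X ≡ 1#
    negative-not-sum X = cong (λ b → if b then 0# else 1#) (dec-false (-[1+ 0 ] ∈SumSet? X) λ { (_ , _ , _ , _ , ()) })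
    L-empty : ∀ a → mem L a ≡ true → a < 0
    L-empty a a∈L = subst (a <_) (m+n≡0⇒m≡0 ℓ (n≤0⇒n≡0 2ℓ≤0)) (mem-all L L-low a a∈L)

  Formula : ℤ → Set r
  Formula i =
    (¬ (+ 2 ∣ i) → probNotInSumSet n ℓ u L U p i ≈ (q ^ ∣ L ∣) * ((1# - p * p) ^ (⌊ ℤ.∣ i ℤ.+ + 1 ∣ /2⌋ ∸ ℓ)))
    × (+ 2 ∣ i → probNotInSumSet n ℓ u L U p i ≈ (q ^ (∣ L ∣ ℕ.+ 1)) * ((1# - p * p) ^ (⌊ ℤ.∣ i ∣ /2⌋ ∸ ℓ)))

lemma2p1 : {c r : Level} (𝓡 : CommutativeRing c r) (n ℓ u : ℕ) → ℓ ℕ.+ u ℕ.≤ n →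
    (L U : Subset n) → (∀ k → k ∈ L → toℕ k ℕ.< ℓ) → (∀ k → k ∈ U → n ∸ u ℕ.≤ toℕ k) →
    (p : CommutativeRing.Carrier 𝓡) → (i : ℤ) →
    + (2 ℕ.* ℓ) ℤ.≤ i ℤ.+ + 1 → i ℤ.+ + 1 ℤ.≤ + (n ∸ u) →
    let open Prob 𝓡 in
    (¬ (+ 2 ∣ i) → probNotInSumSet n ℓ u L U p i ≈ ((1# - p) ^ ∣ L ∣) * ((1# - p * p) ^ (⌊ ℤ.∣ i ℤ.+ + 1 ∣ /2⌋ ∸ ℓ)))
    × (+ 2 ∣ i → probNotInSumSet n ℓ u L U p i ≈ ((1# - p) ^ (∣ L ∣ ℕ.+ 1)) * ((1# - p * p) ^ (⌊ ℤ.∣ i ∣ /2⌋ ∸ ℓ)))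
lemma2p1 𝓡 n ℓ u ℓ+u≤n L U L-low U-high p = by-sign
  where
  open Setting 𝓡 p ℓ+u≤n L U L-low U-high
  -- For i = j ≥ 0 split by the parity of j; i = -1 forces ℓ = 0; i < -1 violates 2ℓ ≤ i + 1.
  by-parity : ∀ {j} → Halves j → 2 ℕ.* ℓ ≤ j ℕ.+ 1 → j ℕ.+ 1 ≤ n ∸ u → Formula (+ j)
  by-parity (odd m) lo hi = (λ _ → odd-sum m lo hi) , λ 2∣j → contradiction 2∣j (odd-not-divisible m)
  by-parity (even m) lo hi = (λ 2∤j → contradiction (even-divisible m) 2∤j) , λ _ → even-sum m lo hi
  by-sign : ∀ i → + (2 ℕ.* ℓ) ℤ.≤ i ℤ.+ + 1 → i ℤ.+ + 1 ℤ.≤ + (n ∸ u) → Formula i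
  by-sign (+ j) (ℤ.+≤+ lo) (ℤ.+≤+ hi) = by-parity (halves j) lo hi
  by-sign -[1+ 0 ] (ℤ.+≤+ lo) _ = (λ _ → minus-one lo) , λ 2∣1 → contradiction (∣1⇒≡1 2∣1) λ ()
  by-sign -[1+ suc _ ] () _
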